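{- Let $a \geq 2$ and let $S$ be an $a$-cap free configuration. For any edge $e = xy$ ($x<y$) of $S$, let $c(e)$ be the maximum size of a cap in $S$ starting with the edge $e$. Then the function $s(e) = c(e) - 1$ is a slope labeling of $S$; in particular, a slope labeling of $S$ always exists.
   Context: A configuration is a finite set $S$ with a linear order $<$, together with an arbitrary assignment, to each $3$-element subset, of "cap" or "cup". Points $x_1 < \cdots < x_m$ form an $m$-cup (resp. $m$-cap) if every consecutive triple $x_{i-1}x_ix_{i+1}$ is labeled cup (resp. cap); 1- and 2-element sets count as both. An edge is a pair $x<y$ of points; a cap or cup $x_1\cdots x_m$ with $m\ge 2$ starts with the edge $x_1x_2$. $S$ is $a$-cap free if it contains no $a$-cap. A slope labeling of an $a$-cap free configuration $S$ is an assignment of an integer $s(xy) \in \{1, \dots, a-2\}$ to every edge $xy$ such that for all $x<y<z$ in $S$, $s(xy) \leq s(yz)$ implies that $\{x,y,z\}$ is a cup. -}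

module Defs where

open import Data.Nat using (ℕ; _≤_; _∸_) renaming (_<_ to _<ℕ_)
open import Data.Fin using (Fin; _<_)
open import Data.Bool using (Bool; true; false)
open import Data.List using (List; []; _∷_; length)
open import Data.List.Relation.Unary.Linked using (Linked)
open import Data.Product using (Σ; _×_; ∃-syntax)
open import Relation.Binary.PropositionalEquality using (_≡_; _≢_)
open import Relation.Nullary using (¬_)

-- A configuration on n points: the point set is Fin n with its natural
-- linear order (every finite linear order is isomorphic to one of these).
-- The label of the 3-element subset {x,y,z} with x < y < z is  lab x y z ,
-- true = "cup", false = "cap".  Values on non-increasing triples are ignored.
Config : ℕ → Set
Config n = Fin n → Fin n → Fin n → Bool

data Consec {n : ℕ} (P : Fin n → Fin n → Fin n → Set) : List (Fin n) → Set where
  c0 : Consec P []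
  c1 : ∀ x → Consec P (x ∷ [])
  c2 : ∀ x y → Consec P (x ∷ y ∷ [])
  c3 : ∀ {x y z rest} → P x y z → Consec P (y ∷ z ∷ rest) → Consec P (x ∷ y ∷ z ∷ rest)

IsCup : {n : ℕ} → Config n → List (Fin n) → Set
IsCup lab xs = Linked _<_ xs × Consec (λ x y z → lab x y z ≡ true) xs

IsCap : {n : ℕ} → Config n → List (Fin n) → Set
IsCap lab xs = Linked _<_ xs × Consec (λ x y z → lab x y z ≡ false) xs

CapFree : {n : ℕ} → ℕ → Config n → Set
CapFree {n} a lab = ∀ (xs : List (Fin n)) → IsCap lab xs → length xs ≢ a

IsSlopeLabeling : {n : ℕ} → ℕ → Config n → ((x y : Fin n) → x < y → ℕ) → Set
IsSlopeLabeling {n} a lab s =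
  (∀ (x y : Fin n) (p : x < y) → 1 ≤ s x y p × s x y p ≤ a ∸ 2) ×
  (∀ (x y z : Fin n) (p : x < y) (q : y < z) → s x y p ≤ s y z q → lab x y z ≡ true)

IsMaxCapSize : {n : ℕ} → Config n → ((x y : Fin n) → x < y → ℕ) → Set
IsMaxCapSize {n} lab c = ∀ (x y : Fin n) (p : x < y) →
  (∃[ rest ] (IsCap lab (x ∷ y ∷ rest) × length (x ∷ y ∷ rest) ≡ c x y p)) ×
  (∀ rest → IsCap lab (x ∷ y ∷ rest) → length (x ∷ y ∷ rest) ≤ c x y p)

{-# OPTIONS --safe #-}
module Submission where

-- Prolonging a cap y z … to the left by x gives a cap exactly when xyz is a cap, so the
-- maximal cap sizes satisfy  c(xy) ≥ c(yz) + 1  for every cap xyz; hence  c(xy) ≤ c(yz)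
-- forces xyz to be a cup. Every edge is a 2-cap and caps have fewer than a points, so
-- s = c − 1 takes values in 1 … a − 2. The maximal sizes exist: they are computed by the
-- recursion  c(xy) = max (2, max over caps xyz of c(yz) + 1),  whose depth is bounded by a.

open import Defs
open import Data.Nat as ℕ using (ℕ; _≤_; _∸_; zero; suc; z≤n; s≤s)
open import Data.Nat.Properties using (≤-trans; ≤-refl; module ≤-Reasoning; ≤∧≢⇒<; ∸-monoˡ-≤; ∸-monoˡ-<; <⇒≱; n≤1+n; m≤n+m)
open import Data.Fin using (Fin; _<_)
open import Data.Fin.Properties using (_<?_)
open import Data.Bool using (true; false)
open import Data.Bool.Properties using (_≟_)
open import Data.List using (List; []; _∷_; length; map; allFin)
open import Data.List.Extrema.Nat using (max; argmax-all; xs≤max; ⊥≤max)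
open import Data.List.Relation.Unary.All as All using (All)
open import Data.List.Relation.Unary.All.Properties using (map⁺)
open import Data.List.Relation.Unary.Linked as Linked using ([-]; _∷_)
open import Data.List.Membership.Propositional.Properties using (∈-allFin; ∈-map⁺)
open import Data.Product using (_×_; ∃-syntax; _,_; proj₁; proj₂)
open import Relation.Nullary using (yes; no; contradiction; _×-dec_; Dec)
open import Function using (id)
open import Relation.Binary.PropositionalEquality using (_≡_; refl; cong; subst)

Consec-tail : ∀ {n} {P : Fin n → Fin n → Fin n → Set} {x xs} → Consec P (x ∷ xs) → Consec P xs
Consec-tail (c1 _)   = c0
Consec-tail (c2 _ y) = c1 y
Consec-tail (c3 _ c) = c

module _ {n : ℕ} (lab : Config n) where

  IsCap-edge : ∀ {x y} → x < y → IsCap lab (x ∷ y ∷ [])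
  IsCap-edge x<y = x<y ∷ [-] , c2 _ _

  IsCap-tail : ∀ {x xs} → IsCap lab (x ∷ xs) → IsCap lab xs
  IsCap-tail (linked , consec) = Linked.tail linked , Consec-tail consec

  IsCap-∷ : ∀ {x y z rest} → x < y → lab x y z ≡ false →
            IsCap lab (y ∷ z ∷ rest) → IsCap lab (x ∷ y ∷ z ∷ rest)
  IsCap-∷ x<y xyz-cap (linked , consec) = x<y ∷ linked , c3 xyz-cap consec

  CapFree⇒length< : ∀ {a} → CapFree a lab → ∀ {xs} → IsCap lab xs → length xs ℕ.< a
  CapFree⇒length< {a} capFree {xs} cap = ≤∧≢⇒< (length≤ xs cap) (capFree xs cap)
    where
    length≤ : ∀ xs → IsCap lab xs → length xs ≤ a
    length≤ []       _   = z≤n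
    length≤ (_ ∷ xs) cap = CapFree⇒length< capFree (IsCap-tail cap)

  Prolongs : Fin n → Fin n → Fin n → Set
  Prolongs x y z = y < z × lab x y z ≡ false

  prolongs? : ∀ x y z → Dec (Prolongs x y z)
  prolongs? x y z = (y <? z) ×-dec (lab x y z ≟ false)

  CapOfLength : Fin n → Fin n → ℕ → Set
  CapOfLength x y m = ∃[ rest ] (IsCap lab (x ∷ y ∷ rest) × length (x ∷ y ∷ rest) ≡ m)

  prolonged : (Fin n → Fin n → ℕ) → Fin n → Fin n → Fin n → ℕ
  prolonged c x y z with prolongs? x y z
  ... | yes _ = suc (c y z)
  ... | no _  = 2

  prolonged-≡ : ∀ c {x y z} → Prolongs x y z → prolonged c x y z ≡ suc (c y z)
  prolonged-≡ c {x} {y} {z} p with prolongs? x y z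
  ... | yes _ = refl
  ... | no ¬p = contradiction p ¬p

  prolongedLengths : (Fin n → Fin n → ℕ) → Fin n → Fin n → List ℕ
  prolongedLengths c x y = map (prolonged c x y) (allFin n)

  -- maximal length of a cap starting with xy and having at most k further points
  longestCap : ℕ → Fin n → Fin n → ℕ
  longestCap zero    x y = 2
  longestCap (suc k) x y = max 2 (prolongedLengths (longestCap k) x y)

  longestCap-attained : ∀ k {x y} → x < y → CapOfLength x y (longestCap k x y)
  longestCap-attained zero    x<y = [] , IsCap-edge x<y , refl
  longestCap-attained (suc k) {x} {y} x<y =
    argmax-all id {P = CapOfLength x y} ([] , IsCap-edge x<y , refl)
      (map⁺ (All.tabulate {xs = allFin n} λ {z} _ → candidate z))
    where
    candidate : ∀ z → CapOfLength x y (prolonged (longestCap k) x y z)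
    candidate z with prolongs? x y z
    ... | no _ = [] , IsCap-edge x<y , refl
    ... | yes (y<z , xyz-cap) with longestCap-attained k y<z
    ...   | rest , cap , len = z ∷ rest , IsCap-∷ x<y xyz-cap cap , cong suc len

  longestCap≥2 : ∀ k x y → 2 ≤ longestCap k x y
  longestCap≥2 zero    x y = ≤-refl
  longestCap≥2 (suc k) x y = ⊥≤max 2 (prolongedLengths (longestCap k) x y)

  longestCap-maximal : ∀ k {x y} rest → length rest ≤ k →
                       IsCap lab (x ∷ y ∷ rest) → length (x ∷ y ∷ rest) ≤ longestCap k x y
  longestCap-maximal k {x} {y} [] _ _ = longestCap≥2 k x y
  longestCap-maximal (suc k) {x} {y} (z ∷ rest) (s≤s len≤k) cap@(_ ∷ y<z ∷ _ , c3 xyz-cap _) =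
    begin
      suc (length (y ∷ z ∷ rest))    ≤⟨ s≤s (longestCap-maximal k rest len≤k (IsCap-tail cap)) ⟩
      suc (longestCap k y z)         ≡⟨ prolonged-≡ (longestCap k) (y<z , xyz-cap) ⟨
      prolonged (longestCap k) x y z ≤⟨ All.lookup (xs≤max 2 (prolongedLengths (longestCap k) x y))
                                                   (∈-map⁺ _ (∈-allFin z)) ⟩
      longestCap (suc k) x y         ∎
    where open ≤-Reasoning

  longestCap-isMaxCapSize : ∀ {a} → CapFree a lab → IsMaxCapSize lab (λ x y _ → longestCap a x y)
  longestCap-isMaxCapSize {a} capFree x y x<y =
    longestCap-attained a x<y ,
    λ rest cap → longestCap-maximal a rest (≤-trans (m≤n+m _ 3) (CapFree⇒length< capFree cap)) cap

  module _ {c : (x y : Fin n) → x < y → ℕ} (isMax : IsMaxCapSize lab c) where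

    maxCap≥2 : ∀ {x y} (x<y : x < y) → 2 ≤ c x y x<y
    maxCap≥2 x<y = proj₂ (isMax _ _ x<y) [] (IsCap-edge x<y)

    maxCap<a : ∀ {a} → CapFree a lab → ∀ {x y} (x<y : x < y) → c x y x<y ℕ.< a
    maxCap<a {a} capFree x<y with proj₁ (isMax _ _ x<y)
    ... | _ , cap , len = subst (ℕ._< a) len (CapFree⇒length< capFree cap)

    maxCap-prolongs : ∀ {x y z} (x<y : x < y) (y<z : y < z) →
                      lab x y z ≡ false → c y z y<z ℕ.< c x y x<y
    maxCap-prolongs x<y y<z xyz-cap with proj₁ (isMax _ _ y<z)
    ... | rest , cap , len =
      subst (λ m → suc m ≤ c _ _ x<y) len (proj₂ (isMax _ _ x<y) (_ ∷ rest) (IsCap-∷ x<y xyz-cap cap))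

    maxCap-slopeLabeling : ∀ {a} → CapFree a lab → IsSlopeLabeling a lab (λ x y x<y → c x y x<y ∸ 1)
    maxCap-slopeLabeling {a} capFree = inRange , cupIfNotDecreasing
      where
      inRange : ∀ x y (x<y : x < y) → 1 ≤ c x y x<y ∸ 1 × c x y x<y ∸ 1 ≤ a ∸ 2
      inRange x y x<y = ∸-monoˡ-≤ 1 (maxCap≥2 x<y) , ∸-monoˡ-≤ 2 (maxCap<a capFree x<y)

      cupIfNotDecreasing : ∀ x y z (x<y : x < y) (y<z : y < z) →
                           c x y x<y ∸ 1 ≤ c y z y<z ∸ 1 → lab x y z ≡ true
      cupIfNotDecreasing x y z x<y y<z slope≤ with lab x y z in xyz
      ... | true  = refl
      ... | false = contradiction slope≤
        (<⇒≱ (∸-monoˡ-< (maxCap-prolongs x<y y<z xyz) (≤-trans (n≤1+n 1) (maxCap≥2 y<z))))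

theorem3p2 : (a n : ℕ) → 2 ≤ a → (lab : Config n) → CapFree a lab →
    (∃[ c ] IsMaxCapSize lab c) ×
    (∀ (c : (x y : Fin n) → x < y → ℕ) → IsMaxCapSize lab c →
      IsSlopeLabeling a lab (λ x y p → c x y p ∸ 1)) ×
    (∃[ s ] IsSlopeLabeling a lab s)
theorem3p2 a n _ lab capFree =
  (_ , longestCapIsMax) ,
  (λ c isMax → maxCap-slopeLabeling lab isMax capFree) ,
  (_ , maxCap-slopeLabeling lab longestCapIsMax capFree)
  where
  longestCapIsMax : IsMaxCapSize lab (λ x y _ → longestCap lab a x y)
  longestCapIsMax = longestCap-isMaxCapSize lab capFree
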